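{- For all combinators $u,v$ and every variable $x$: (1) $(S\ (K\ u)\ I)\succ^* u$ and $(S\ (K\ u)\ (K\ v))\succ^* (K\ (u\ v))$; (2) $\lambda x.u\rightarrow^*[x]u$ and $\lambda x.u\succ^*[x]u$.
   Context: Combinators: $C ::= x \mid K \mid S \mid I \mid (C\ C)$ with $x$ ranging over variables; application associates to the left. $[x]u$ is defined by the first applicable rule: $[x]u=(K\ u)$ if $x\notin u$; $[x]x=I$; $[x](u\ x)=u$ if $x\notin u$; $[x](u\ v)=(S\ [x]u\ [x]v)$ otherwise. $\lambda x.u$ is defined by the first applicable rule: $\lambda x.u=(K\ u)$ if $x\notin u$; $\lambda x.x=I$; $\lambda x.(u\ v)=(S\ \lambda x.u\ \lambda x.v)$ otherwise. The strong reduction $\succ$ is the closure under application contexts of $(K\ u\ v)\succ u$, $(S\ u\ v\ w)\succ(u\ w\ (v\ w))$, $(I\ u)\succ u$, plus: $[x]u\succ[x]v$ whenever $u\succ v$. The reduction $\rightarrow$ is the closure under application contexts of $(K\ u\ v)\rightarrow u$, $(S\ u\ v\ w)\rightarrow(u\ w\ (v\ w))$, $(I\ u)\rightarrow u$, $(S\ (K\ u)\ (K\ v))\rightarrow(K\ (u\ v))$, $(S\ (K\ u)\ I)\rightarrow u$, plus: $\lambda x.u\rightarrow\lambda x.v$ whenever $u\rightarrow v$. A star denotes reflexive–transitive closure. -}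

module Defs where

open import Data.Nat using (ℕ; _≡ᵇ_)
open import Data.Bool using (Bool; true; false; _∨_; _∧_; not; if_then_else_)
open import Relation.Binary.Construct.Closure.ReflexiveTransitive using (Star)

infixl 9 _·_

data Comb : Set where
  var : ℕ → Comb
  K S I : Comb
  _·_ : Comb → Comb → Comb

occurs : ℕ → Comb → Bool
occurs x (var y) = x ≡ᵇ y
occurs x K = false
occurs x S = false
occurs x I = false
occurs x (u · v) = occurs x u ∨ occurs x v

-- [x]u, first applicable rule:
--  [x]u = K u if x ∉ u ; [x]x = I ; [x](u x) = u if x ∉ u ; [x](u v) = S [x]u [x]v
mutual
  bracket : ℕ → Comb → Comb
  bracket x u = if occurs x u then bracketOcc x u else K · u

  bracketOcc : ℕ → Comb → Comb
  bracketOcc x (var y) = I            -- here y = x, since x occurs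
  bracketOcc x K = K · K              -- unreachable (x ∉ K)
  bracketOcc x S = K · S              -- unreachable
  bracketOcc x I = K · I              -- unreachable
  bracketOcc x (u · var y) =
    if (x ≡ᵇ y) ∧ not (occurs x u) then u else S · bracket x u · bracket x (var y)
  bracketOcc x (u · v@K) = S · bracket x u · bracket x v
  bracketOcc x (u · v@S) = S · bracket x u · bracket x v
  bracketOcc x (u · v@I) = S · bracket x u · bracket x v
  bracketOcc x (u · v@(_ · _)) = S · bracket x u · bracket x v

-- λx.u, first applicable rule:
--  λx.u = K u if x ∉ u ; λx.x = I ; λx.(u v) = S λx.u λx.v
mutual
  lam : ℕ → Comb → Comb
  lam x u = if occurs x u then lamOcc x u else K · u

  lamOcc : ℕ → Comb → Comb
  lamOcc x (var y) = I                -- here y = x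
  lamOcc x K = K · K                  -- unreachable
  lamOcc x S = K · S                  -- unreachable
  lamOcc x I = K · I                  -- unreachable
  lamOcc x (u · v) = S · lam x u · lam x v

infix 4 _≻_ _⟶_
data _≻_ : Comb → Comb → Set where
  ≻K   : ∀ u v → K · u · v ≻ u
  ≻S   : ∀ u v w → S · u · v · w ≻ u · w · (v · w)
  ≻I   : ∀ u → I · u ≻ u
  ≻appL : ∀ {u u′} v → u ≻ u′ → u · v ≻ u′ · v
  ≻appR : ∀ u {v v′} → v ≻ v′ → u · v ≻ u · v′
  ≻ξ   : ∀ x {u v} → u ≻ v → bracket x u ≻ bracket x v

data _⟶_ : Comb → Comb → Set where
  ⟶K   : ∀ u v → K · u · v ⟶ u
  ⟶S   : ∀ u v w → S · u · v · w ⟶ u · w · (v · w)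
  ⟶I   : ∀ u → I · u ⟶ u
  ⟶SKK : ∀ u v → S · (K · u) · (K · v) ⟶ K · (u · v)
  ⟶SKI : ∀ u → S · (K · u) · I ⟶ u
  ⟶appL : ∀ {u u′} v → u ⟶ u′ → u · v ⟶ u′ · v
  ⟶appR : ∀ u {v v′} → v ⟶ v′ → u · v ⟶ u · v′
  ⟶ξ   : ∀ x {u v} → u ⟶ v → lam x u ⟶ lam x v

infix 4 _≻*_ _⟶*_
_≻*_ : Comb → Comb → Set
_≻*_ = Star _≻_

_⟶*_ : Comb → Comb → Set
_⟶*_ = Star _⟶_

-- Part (1) is the ξ-rule at work: for a variable x not occurring in u and v,
-- S (K u) I = [x]((K u x) (I x)) ≻ [x](u (I x)) ≻ [x](u x) = u, and likewise
-- S (K u) (K v) = [x]((K u x) (K v x)) ≻ [x](u (K v x)) ≻ [x](u v) = K (u v).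
-- Part (2) is an induction on u: λx.u and [x]u are built by the same rules,
-- except that η-redexes u x with x ∉ u give S (K u) I under λ but u under [x],
-- so any relation closed under application contexts that takes S (K u) I to u
-- in finitely many steps takes λx.u to [x]u.
module Submission where

open import Defs
open import Data.Nat using (ℕ; zero; suc; _≡ᵇ_; _⊔_; _<_)
open import Data.Nat.Properties using (<-irrefl; ≤-<-trans; m≤m⊔n; m≤n⊔m; ≤-refl; ≡ᵇ⇒≡)
open import Data.Bool using (true; false; T)
open import Data.Bool.Properties using (∨-conicalˡ; ∨-conicalʳ)
open import Data.Product using (_×_; _,_)
open import Data.Unit using (tt)
open import Data.Empty using (⊥-elim)
open import Relation.Binary.PropositionalEquality using (_≡_; refl; sym; subst)
open import Relation.Binary.Construct.Closure.ReflexiveTransitive using (Star; ε; _◅_; _◅◅_; gmap)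
open import Relation.Binary.Construct.Closure.ReflexiveTransitive.Properties using (module StarReasoning)

≡ᵇ-refl : ∀ n → (n ≡ᵇ n) ≡ true
≡ᵇ-refl zero = refl
≡ᵇ-refl (suc n) = ≡ᵇ-refl n

maxVar : Comb → ℕ
maxVar (var y) = y
maxVar K = 0
maxVar S = 0
maxVar I = 0
maxVar (a · b) = maxVar a ⊔ maxVar b

maxVar<⇒occurs≡false : ∀ {n} u → maxVar u < n → occurs n u ≡ false
maxVar<⇒occurs≡false {n} (var y) y<n with n ≡ᵇ y in eq
... | false = refl
... | true = ⊥-elim (<-irrefl (sym (≡ᵇ⇒≡ n y (subst T (sym eq) tt))) y<n)
maxVar<⇒occurs≡false K _ = refl
maxVar<⇒occurs≡false S _ = refl
maxVar<⇒occurs≡false I _ = refl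
maxVar<⇒occurs≡false (a · b) ab<n
  rewrite maxVar<⇒occurs≡false a (≤-<-trans (m≤m⊔n (maxVar a) (maxVar b)) ab<n)
        | maxVar<⇒occurs≡false b (≤-<-trans (m≤n⊔m (maxVar a) (maxVar b)) ab<n) = refl

fresh : Comb → ℕ
fresh u = suc (maxVar u)

occurs-fresh : ∀ u → occurs (fresh u) u ≡ false
occurs-fresh u = maxVar<⇒occurs≡false u ≤-refl

S-K-I-≻* : ∀ u → S · (K · u) · I ≻* u
S-K-I-≻* u = begin
  S · (K · u) · I                         ≡⟨ sym [x]KuxIx ⟩
  bracket x (K · u · var x · (I · var x)) ⟶⟨ ≻ξ x (≻appL _ (≻K u (var x))) ⟩
  bracket x (u · (I · var x))             ⟶⟨ ≻ξ x (≻appR u (≻I (var x))) ⟩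
  bracket x (u · var x)                   ≡⟨ [x]ux ⟩
  u                                       ∎
  where
  open StarReasoning _≻_
  x : ℕ
  x = fresh u
  x∉u : occurs x u ≡ false
  x∉u = occurs-fresh u
  [x]KuxIx : bracket x (K · u · var x · (I · var x)) ≡ S · (K · u) · I
  [x]KuxIx rewrite x∉u | ≡ᵇ-refl x = refl
  [x]ux : bracket x (u · var x) ≡ u
  [x]ux rewrite x∉u | ≡ᵇ-refl x = refl

S-K-K-≻* : ∀ u v → S · (K · u) · (K · v) ≻* K · (u · v)
S-K-K-≻* u v = begin
  S · (K · u) · (K · v)                       ≡⟨ sym [x]KuxKvx ⟩
  bracket x (K · u · var x · (K · v · var x)) ⟶⟨ ≻ξ x (≻appL _ (≻K u (var x))) ⟩
  bracket x (u · (K · v · var x))             ⟶⟨ ≻ξ x (≻appR u (≻K v (var x))) ⟩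
  bracket x (u · v)                           ≡⟨ [x]uv ⟩
  K · (u · v)                                 ∎
  where
  open StarReasoning _≻_
  x : ℕ
  x = fresh (u · v)
  x∉u : occurs x u ≡ false
  x∉u = ∨-conicalˡ _ _ (occurs-fresh (u · v))
  x∉v : occurs x v ≡ false
  x∉v = ∨-conicalʳ _ _ (occurs-fresh (u · v))
  [x]KuxKvx : bracket x (K · u · var x · (K · v · var x)) ≡ S · (K · u) · (K · v)
  [x]KuxKvx rewrite x∉u | x∉v | ≡ᵇ-refl x = refl
  [x]uv : bracket x (u · v) ≡ K · (u · v)
  [x]uv rewrite x∉u | x∉v = refl

module LamToBracket
  (_↝_ : Comb → Comb → Set)
  (↝-appL : ∀ {a a′} b → a ↝ a′ → (a · b) ↝ (a′ · b))
  (↝-appR : ∀ a {b b′} → b ↝ b′ → (a · b) ↝ (a · b′))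
  (S-K-I-↝* : ∀ a → Star _↝_ (S · (K · a) · I) a)
  where

  S-cong-↝* : ∀ {a a′ b b′} → Star _↝_ a a′ → Star _↝_ b b′ → Star _↝_ (S · a · b) (S · a′ · b′)
  S-cong-↝* {a′ = a′} a↝*a′ b↝*b′ =
    gmap (λ c → S · c · _) (λ r → ↝-appL _ (↝-appR S r)) a↝*a′
    ◅◅ gmap (S · a′ ·_) (↝-appR (S · a′)) b↝*b′

  lam↝*bracket : ∀ x u → Star _↝_ (lam x u) (bracket x u)
  lamOcc↝*bracketOcc : ∀ x a b → Star _↝_ (lamOcc x (a · b)) (bracketOcc x (a · b))

  lam↝*bracket x (var y) with occurs x (var y)
  ... | true = ε
  ... | false = ε
  lam↝*bracket x K = ε
  lam↝*bracket x S = ε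
  lam↝*bracket x I = ε
  lam↝*bracket x (a · b) with occurs x (a · b)
  ... | true = lamOcc↝*bracketOcc x a b
  ... | false = ε

  lamOcc↝*bracketOcc x a (var y) with x ≡ᵇ y | occurs x a | lam↝*bracket x a | lam↝*bracket x (var y)
  ... | true | false | _ | _ = S-K-I-↝* a
  ... | true | true | a↝* | y↝* = S-cong-↝* a↝* y↝*
  ... | false | _ | a↝* | y↝* = S-cong-↝* a↝* y↝*
  lamOcc↝*bracketOcc x a K = S-cong-↝* (lam↝*bracket x a) (lam↝*bracket x K)
  lamOcc↝*bracketOcc x a S = S-cong-↝* (lam↝*bracket x a) (lam↝*bracket x S)
  lamOcc↝*bracketOcc x a I = S-cong-↝* (lam↝*bracket x a) (lam↝*bracket x I)
  lamOcc↝*bracketOcc x a (b · c) = S-cong-↝* (lam↝*bracket x a) (lam↝*bracket x (b · c))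

lemma2 : (u v : Comb) (x : ℕ) →
    ((S · (K · u) · I ≻* u) × (S · (K · u) · (K · v) ≻* K · (u · v)))
    × ((lam x u ⟶* bracket x u) × (lam x u ≻* bracket x u))
lemma2 u v x =
  (S-K-I-≻* u , S-K-K-≻* u v) ,
  (LamToBracket.lam↝*bracket _⟶_ ⟶appL ⟶appR (λ a → ⟶SKI a ◅ ε) x u ,
   LamToBracket.lam↝*bracket _≻_ ≻appL ≻appR S-K-I-≻* x u)
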